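{- Let $n\ge 2$ and $A\in CP_n$. Then $n\le \exp(A)\le (n-1)^2+1$. Moreover, there exists a unique $A\in CP_n$ such that $\exp(A)=n$.
   Context: For $n \ge 2$, $C_n$ is the set of all $n\times n$ $(0,1)$-matrices $A=(a_{ij})$ with $a_{i,i+1}=1$ for $1\le i\le n-1$, last row arbitrary in $\{0,1\}^n$, and all other entries $0$. These are the $(0,1)$ companion matrices of $x^n-\sum_{i=0}^{n-1}a_ix^i$, $a_i\in\{0,1\}$. A nonnegative matrix $A$ is primitive if $A^m$ has all entries positive for some positive integer $m$. The smallest such $m$ is the exponent $\exp(A)$. $CP_n$ is the set of primitive matrices in $C_n$. -}

module Defs where

open import Data.Nat using (ℕ; _+_; _*_; _<_; _≤_; _∸_)
open import Data.Bool using (Bool; true; false)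
open import Data.Fin using (Fin; toℕ; zero; suc)
open import Data.Vec using (Vec; lookup)
open import Data.Product using (Σ; _×_; ∃)
open import Relation.Binary.PropositionalEquality using (_≡_)
open import Relation.Nullary using (¬_)

Matrix : ℕ → Set
Matrix n = Fin n → Fin n → ℕ

sumFin : ∀ {n} → (Fin n → ℕ) → ℕ
sumFin {ℕ.zero}  f = 0
sumFin {ℕ.suc n} f = f zero + sumFin (λ i → f (suc i))

_⊗_ : ∀ {n} → Matrix n → Matrix n → Matrix n
(A ⊗ B) i j = sumFin (λ k → A i k * B k j)

identity : ∀ {n} → Matrix n
identity i j with toℕ i Data.Nat.≟ toℕ j
... | Relation.Nullary.yes _ = 1
... | Relation.Nullary.no  _ = 0

_^ᴹ_ : ∀ {n} → Matrix n → ℕ → Matrix n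
A ^ᴹ ℕ.zero    = identity
A ^ᴹ (ℕ.suc m) = A ⊗ (A ^ᴹ m)

Positive : ∀ {n} → Matrix n → Set
Positive A = ∀ i j → 0 < A i j

Primitive : ∀ {n} → Matrix n → Set
Primitive A = Σ ℕ λ m → (1 ≤ m) × Positive (A ^ᴹ m)

IsExponent : ∀ {n} → Matrix n → ℕ → Set
IsExponent A m = (1 ≤ m) × Positive (A ^ᴹ m) × (∀ k → 1 ≤ k → k < m → ¬ Positive (A ^ᴹ k))

b2n : Bool → ℕ
b2n true  = 1
b2n false = 0

-- the (0,1) companion matrix with superdiagonal ones and last row r
-- (the matrices of C_n are exactly companion n r for r ∈ {0,1}^n)
companion : (n : ℕ) → Vec Bool n → Matrix n
companion n r i j with ℕ.suc (toℕ i) Data.Nat.≟ n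
... | Relation.Nullary.yes _ = b2n (lookup r j)
... | Relation.Nullary.no  _ with ℕ.suc (toℕ i) Data.Nat.≟ toℕ j
...   | Relation.Nullary.yes _ = 1
...   | Relation.Nullary.no  _ = 0

module Submission where

-- A nonnegative matrix is read as a digraph (edge i → j when A i j > 0), so
-- that (A^t) i j > 0 means there is a walk of length t from i to j.  The
-- companion matrix on vertices 0, …, p (n = p + 1) has the edges i → i+1 for
-- i < p and p → j whenever r_j = 1.
--   * Lower bound: a walk of length t ≤ p from 0 is forced along the
--     superdiagonal, so (A^t) 0 0 = 0 for 1 ≤ t ≤ p and exp(A) ≥ n.
--   * Upper bound (Wielandt): primitivity gives r_0 = 1 and r_s = 1 for some
--     s ≥ 1, hence a cycle of length ℓ ≤ p through p.  The endpoint sets of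
--     walks from p of lengths 1 + kℓ form a growing chain of subsets that
--     starts with two elements and gains one per step until full, so row p
--     of A^(1+(p-1)p) is positive; p more steps make all of A^(p²+1) positive.
--   * Uniqueness: A^n > 0 makes every walk 0 → j of length n end with an edge
--     p → j, so r is all ones; conversely the all-ones row has exp(A) = n.

open import Defs
open import Data.Nat using (ℕ; _≤_; _+_; _*_; _∸_)
open import Data.Bool using (Bool)
open import Data.Vec using (Vec)
open import Data.Product using (Σ; _×_)
open import Relation.Binary.PropositionalEquality using (_≡_)

open import Data.Nat using (zero; suc; _<_; z≤n; s≤s; s≤s⁻¹; z<s; _≟_; _<?_; _≤?_)
open import Data.Nat.Properties
open import Data.Bool using (true) renaming (_≟_ to _≟ᴮ_)
open import Data.Fin using (Fin; toℕ; fromℕ; inject₁) renaming (zero to fz; suc to fs)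
open import Data.Fin.Properties using (toℕ-injective; toℕ-fromℕ; toℕ<n; toℕ≤pred[n]; toℕ-inject₁; any?)
open import Data.Fin.Subset using (Subset; _∈_; _⊆_; _⊂_; ∣_∣; ⁅_⁆)
open import Data.Fin.Subset.Properties
  using (_∈?_; _⊂?_; ∈⊤; ∣p∣≤n; ∣p∣≡n⇒p≡⊤; p⊂q⇒∣p∣<∣q∣; ∣⁅x⁆∣≡1; x∈⁅y⁆⇒x≡y; x≢y⇒x∉⁅y⁆)
open import Data.Vec using (lookup; tabulate; replicate; []; _∷_)
open import Data.Vec.Properties using (lookup∘tabulate; lookup⇒[]=; []=⇒lookup; lookup-replicate)
open import Data.Product using (_,_; proj₁; proj₂; ∃)
open import Data.Sum using (_⊎_; inj₁; inj₂; [_,_]′)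
open import Function using (_∘_)
open import Relation.Nullary using (¬_; Dec; yes; no; does; contradiction)
open import Relation.Nullary.Decidable using (dec-true; _×-dec_)
open import Relation.Binary.PropositionalEquality using (refl; sym; trans; cong; cong₂; subst; _≢_)

-- Both are records so that their indices can be
-- inferred from them.
record Edge {n} (A : Matrix n) (i j : Fin n) : Set where
  constructor edge
  field positive : 0 < A i j

record Walk {n} (A : Matrix n) (t : ℕ) (i j : Fin n) : Set where
  constructor walk
  field positive : 0 < (A ^ᴹ t) i j

sumFin-positive⁻ : ∀ {n} (f : Fin n → ℕ) → 0 < sumFin f → ∃ λ k → 0 < f k
sumFin-positive⁻ {suc n} f pos with f fz in eq
... | zero  = let (k , fk) = sumFin-positive⁻ (f ∘ fs) pos in fs k , fk
... | suc _ = fz , subst (0 <_) (sym eq) z<s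

sumFin-positive⁺ : ∀ {n} (f : Fin n → ℕ) k → 0 < f k → 0 < sumFin f
sumFin-positive⁺ {suc n} f fz     fk = ≤-trans fk (m≤m+n (f fz) _)
sumFin-positive⁺ {suc n} f (fs k) fk = ≤-trans (sumFin-positive⁺ (f ∘ fs) k fk) (m≤n+m _ (f fz))

*-positive⁻ : ∀ a b → 0 < a * b → (0 < a) × (0 < b)
*-positive⁻ (suc a) (suc b) _ = z<s , z<s
*-positive⁻ (suc a) zero pos = contradiction (subst (0 <_) (*-zeroʳ a) pos) λ ()

*-positive⁺ : ∀ {a b} → 0 < a → 0 < b → 0 < a * b
*-positive⁺ {suc a} {suc b} _ _ = z<s

identity-diagonal : ∀ {n} (i : Fin n) → 0 < identity i i
identity-diagonal i with toℕ i ≟ toℕ i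
... | yes _   = z<s
... | no  i≢i = contradiction refl i≢i

identity-positive⁻ : ∀ {n} (i j : Fin n) → 0 < identity i j → i ≡ j
identity-positive⁻ i j pos with toℕ i ≟ toℕ j
... | yes i≡j = toℕ-injective i≡j
... | no  _   = contradiction pos λ ()

walk-[] : ∀ {n} (A : Matrix n) i → Walk A 0 i i
walk-[] A i = walk (identity-diagonal i)

walk-[]⁻ : ∀ {n} (A : Matrix n) {i j} → Walk A 0 i j → i ≡ j
walk-[]⁻ A (walk w) = identity-positive⁻ _ _ w

walk-∷ : ∀ {n} (A : Matrix n) {t i k j} → Edge A i k → Walk A t k j → Walk A (suc t) i j
walk-∷ A {k = k} (edge e) (walk w) = walk (sumFin-positive⁺ _ k (*-positive⁺ e w))

walk-uncons : ∀ {n} (A : Matrix n) {t i j} → Walk A (suc t) i j → ∃ λ k → Edge A i k × Walk A t k j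
walk-uncons A (walk w) = let (k , pos) = sumFin-positive⁻ _ w ; (e , w′) = *-positive⁻ _ _ pos in k , edge e , walk w′

walk-++ : ∀ {n} (A : Matrix n) {s t i k j} → Walk A s i k → Walk A t k j → Walk A (s + t) i j
walk-++ A {zero}  w v = subst (λ x → Walk A _ x _) (sym (walk-[]⁻ A w)) v
walk-++ A {suc s} w v = let (m , e , w′) = walk-uncons A w in walk-∷ A e (walk-++ A w′ v)

walk-split : ∀ {n} (A : Matrix n) s {t i j} → Walk A (s + t) i j → ∃ λ k → Walk A s i k × Walk A t k j
walk-split A zero    {i = i} w = i , walk-[] A i , w
walk-split A (suc s) w =
  let (m , e , w′)  = walk-uncons A w
      (k , u , v)   = walk-split A s w′
  in k , walk-∷ A e u , v

edge⇒walk : ∀ {n} (A : Matrix n) {i j} → Edge A i j → Walk A 1 i j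
edge⇒walk A {j = j} e = walk-∷ A e (walk-[] A j)

walk⇒edge : ∀ {n} (A : Matrix n) {i j} → Walk A 1 i j → Edge A i j
walk⇒edge A w = let (k , e , w′) = walk-uncons A w in subst (Edge A _) (walk-[]⁻ A w′) e

walk-cast : ∀ {n} (A : Matrix n) {t t′ i j} → t ≡ t′ → Walk A t i j → Walk A t′ i j
walk-cast A {i = i} {j} = subst (λ x → Walk A x i j)

walk-snoc : ∀ {n} (A : Matrix n) {t i k j} → Walk A t i k → Edge A k j → Walk A (suc t) i j
walk-snoc A {t} w e = walk-cast A (+-comm t 1) (walk-++ A w (edge⇒walk A e))

walk-unsnoc : ∀ {n} (A : Matrix n) {t i j} → Walk A (suc t) i j → ∃ λ k → Walk A t i k × Edge A k j
walk-unsnoc A {t} w =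
  let (k , u , v) = walk-split A t (walk-cast A (+-comm 1 t) w)
  in k , u , walk⇒edge A v

walk-deterministic : ∀ {n} (A : Matrix n) → (∀ {i k k′} → Edge A i k → Edge A i k′ → k ≡ k′) →
                     ∀ {t i j j′} → Walk A t i j → Walk A t i j′ → j ≡ j′
walk-deterministic A functional {zero} w w′ = trans (sym (walk-[]⁻ A w)) (walk-[]⁻ A w′)
walk-deterministic A functional {suc t} w w′
  with walk-uncons A w | walk-uncons A w′
... | k , e , v | k′ , e′ , v′ with functional e e′
... | refl = walk-deterministic A functional v v′

row-positive-mono : ∀ {n} (A : Matrix n) → (∀ j → ∃ λ k → Edge A k j) →
                    ∀ {t t′ a} → (∀ j → Walk A t a j) → t ≤ t′ → ∀ j → Walk A t′ a j
row-positive-mono A in-edge {t} {t′} {a} row t≤t′ j =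
  walk-cast A (m∸n+n≡m t≤t′) (extend (t′ ∸ t) j)
  where
  extend : ∀ d j → Walk A (d + t) a j
  extend zero    j = row j
  extend (suc d) j = let (k , e) = in-edge j in walk-snoc A (extend d k) e

-- A primitive matrix has no zero column: the last step of a closed walk
-- of length m ≥ 1 at j enters j.
primitive⇒in-edges : ∀ {n} (A : Matrix n) → Primitive A → ∀ j → ∃ λ k → Edge A k j
primitive⇒in-edges A (suc m , _ , pos) j = let (k , _ , e) = walk-unsnoc A {m} (walk (pos j j)) in k , e

exponent≤positive-power : ∀ {n} (A : Matrix n) {e N} → IsExponent A e → 1 ≤ N → Positive (A ^ᴹ N) → e ≤ N
exponent≤positive-power A {e} {N} (_ , _ , minimal) 1≤N pos with e ≤? N
... | yes e≤N = e≤N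
... | no  e≰N = contradiction pos (minimal N 1≤N (≰⇒> e≰N))

-- It is only used through
-- the two membership lemmas below; keeping it opaque stops the type checker
-- from unfolding matrix powers when it compares such sets.
opaque
  reach : ∀ {n} → Matrix n → ℕ → Fin n → Subset n
  reach A t i = tabulate (λ j → does (0 <? (A ^ᴹ t) i j))

opaque
  unfolding reach

  walk⇒∈reach : ∀ {n} (A : Matrix n) {t i j} → Walk A t i j → j ∈ reach A t i
  walk⇒∈reach A {t} {i} {j} (walk w) =
    lookup⇒[]= j _ (trans (lookup∘tabulate _ j) (dec-true (0 <? (A ^ᴹ t) i j) w))

  ∈reach⇒walk : ∀ {n} (A : Matrix n) {t i j} → j ∈ reach A t i → Walk A t i j
  ∈reach⇒walk A {t} {i} {j} j∈ =
    walk (witness (0 <? (A ^ᴹ t) i j) (trans (sym (lookup∘tabulate _ j)) ([]=⇒lookup j∈)))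
    where
    witness : ∀ {P : Set} (p? : Dec P) → does p? ≡ true → P
    witness (yes p) _ = p

Full : ∀ {n} → Subset n → Set
Full p = ∀ x → x ∈ p

large⇒full : ∀ {n} (p : Subset n) → n ≤ ∣ p ∣ → Full p
large⇒full p n≤∣p∣ x = subst (x ∈_) (sym (∣p∣≡n⇒p≡⊤ (≤-antisym (∣p∣≤n p) n≤∣p∣))) ∈⊤

two-elements : ∀ {n} (p : Subset n) {x y} → x ∈ p → y ∈ p → y ≢ x → 2 ≤ ∣ p ∣
two-elements p {x} {y} x∈p y∈p y≢x = subst (_< ∣ p ∣) (∣⁅x⁆∣≡1 x) (p⊂q⇒∣p∣<∣q∣ ⁅x⁆⊂p)
  where
  ⁅x⁆⊂p : ⁅ x ⁆ ⊂ p
  ⁅x⁆⊂p = (λ z∈⁅x⁆ → subst (_∈ p) (sym (x∈⁅y⁆⇒x≡y x z∈⁅x⁆)) x∈p) , y , y∈p , x≢y⇒x∉⁅y⁆ y≢x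

module GrowingChain {n} (X : ℕ → Subset n)
                        (grows : ∀ k → X k ⊆ X (suc k))
                        (stagnation-persists : ∀ k → X (suc k) ⊆ X k → X (suc (suc k)) ⊆ X (suc k))
                        (K : ℕ) (full-at-K : Full (X K)) where

  grows-by : ∀ d k → X k ⊆ X (d + k)
  grows-by zero    k x∈ = x∈
  grows-by (suc d) k x∈ = grows (d + k) (grows-by d k x∈)

  -- Once the chain stagnates it is constant, hence equal to X K, hence full.
  stagnant-forever : ∀ k → X (suc k) ⊆ X k → ∀ d → X (suc (d + k)) ⊆ X (d + k)
  stagnant-forever k stuck zero    = stuck
  stagnant-forever k stuck (suc d) = stagnation-persists (d + k) (stagnant-forever k stuck d)

  shrinks-back : ∀ k → X (suc k) ⊆ X k → ∀ d → X (d + k) ⊆ X k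
  shrinks-back k stuck zero    x∈ = x∈
  shrinks-back k stuck (suc d) x∈ = shrinks-back k stuck d (stagnant-forever k stuck d x∈)

  stagnant⇒full : ∀ k → X (suc k) ⊆ X k → Full (X k)
  stagnant⇒full k stuck x with ≤-total K k
  ... | inj₁ K≤k = subst (λ i → x ∈ X i) (m∸n+n≡m K≤k) (grows-by (k ∸ K) K (full-at-K x))
  ... | inj₂ k≤K = shrinks-back k stuck (K ∸ k) (subst (λ i → x ∈ X i) (sym (m∸n+n≡m k≤K)) (full-at-K x))

  not-strict⇒stagnant : ∀ k → ¬ (X k ⊂ X (suc k)) → X (suc k) ⊆ X k
  not-strict⇒stagnant k not-strict {x} x∈ with x ∈? X k
  ... | yes x∈X = x∈X
  ... | no  x∉X = contradiction ((λ {y} → grows k {y}) , x , x∈ , x∉X) not-strict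

  fills : ∀ k → Full (X k) ⊎ ∣ X 0 ∣ + k ≤ ∣ X k ∣
  fills zero = inj₂ (≤-reflexive (+-identityʳ _))
  fills (suc k) with fills k
  ... | inj₁ full = inj₁ (λ x → grows k (full x))
  ... | inj₂ size with X k ⊂? X (suc k)
  ...   | yes strict = inj₂ (subst (_≤ ∣ X (suc k) ∣) (sym (+-suc _ k)) (≤-trans (s≤s size) (p⊂q⇒∣p∣<∣q∣ strict)))
  ...   | no  not-strict =
            inj₁ (λ x → grows k (stagnant⇒full k (not-strict⇒stagnant k not-strict) x))

-- Given a closed walk of length ℓ at v, the sets of endpoints of walks from v
-- of lengths a, a + ℓ, a + 2ℓ, … increase (prefix the cycle), and
-- X (k+1) is obtained from X k by following walks of length ℓ, so one step
-- of stagnation propagates: the hypotheses of GrowingChain.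
module CycleChain {n} (A : Matrix n) {ℓ v} (cycle : Walk A ℓ v v) (a : ℕ) where

  time : ℕ → ℕ
  time k = a + k * ℓ

  X : ℕ → Subset n
  X k = reach A (time k) v

  time-step : ∀ k → time k + ℓ ≡ time (suc k)
  time-step k = trans (+-assoc a (k * ℓ) ℓ) (cong (a +_) (+-comm (k * ℓ) ℓ))

  grows : ∀ k → X k ⊆ X (suc k)
  grows k x∈ = walk⇒∈reach A (walk-cast A (trans (+-comm ℓ (time k)) (time-step k))
                                           (walk-++ A cycle (∈reach⇒walk A x∈)))

  stagnation-persists : ∀ k → X (suc k) ⊆ X k → X (suc (suc k)) ⊆ X (suc k)
  stagnation-persists k stuck x∈ =
    let (m , u , w) = walk-split A (time (suc k)) (walk-cast A (sym (time-step (suc k))) (∈reach⇒walk A x∈))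
    in walk⇒∈reach A (walk-cast A (time-step k) (walk-++ A (∈reach⇒walk A (stuck (walk⇒∈reach A u))) w))

all-lookups⇒replicate : ∀ {A : Set} {n} (v : Vec A n) {x} → (∀ j → lookup v j ≡ x) → v ≡ replicate n x
all-lookups⇒replicate []      _      = refl
all-lookups⇒replicate (y ∷ v) v[j]≡x = cong₂ _∷_ (v[j]≡x fz) (all-lookups⇒replicate v (v[j]≡x ∘ fs))

b2n-positive : ∀ b → 0 < b2n b → b ≡ true
b2n-positive true _ = refl

module Companion (p : ℕ) (r : Vec Bool (suc p)) where

  A : Matrix (suc p)
  A = companion (suc p) r

  last : Fin (suc p)
  last = fromℕ p

  beyond-last : ∀ (j : Fin (suc p)) → toℕ j ≢ suc p
  beyond-last j j≡p+1 = <-irrefl j≡p+1 (toℕ<n j)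

  edge-last⁺ : ∀ {i j} → toℕ i ≡ p → lookup r j ≡ true → Edge A i j
  edge-last⁺ {i} {j} i≡p rj = edge entry
    where
    entry : 0 < companion (suc p) r i j
    entry with suc (toℕ i) ≟ suc p
    ... | yes _   = subst (λ b → 0 < b2n b) (sym rj) z<s
    ... | no  i≢p = contradiction (cong suc i≡p) i≢p

  edge-next⁺ : ∀ {i j} → toℕ j ≡ suc (toℕ i) → Edge A i j
  edge-next⁺ {i} {j} j≡i+1 = edge entry
    where
    entry : 0 < companion (suc p) r i j
    entry with suc (toℕ i) ≟ suc p
    ... | yes i≡p = contradiction (trans j≡i+1 i≡p) (beyond-last j)
    ... | no  _ with suc (toℕ i) ≟ toℕ j
    ...   | yes _     = z<s
    ...   | no  i+1≢j = contradiction (sym j≡i+1) i+1≢j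

  edge⁻ : ∀ {i j} → Edge A i j → (toℕ i ≡ p × lookup r j ≡ true) ⊎ toℕ j ≡ suc (toℕ i)
  edge⁻ {i} {j} (edge e) = classify e
    where
    classify : 0 < companion (suc p) r i j → (toℕ i ≡ p × lookup r j ≡ true) ⊎ toℕ j ≡ suc (toℕ i)
    classify e with suc (toℕ i) ≟ suc p
    ... | yes i≡p = inj₁ (suc-injective i≡p , b2n-positive (lookup r j) e)
    ... | no  _ with suc (toℕ i) ≟ toℕ j
    ...   | yes i+1≡j = inj₂ (sym i+1≡j)
    ...   | no  _     = contradiction e λ ()

  path : ∀ d {i j} → toℕ j ≡ toℕ i + d → Walk A d i j
  path zero    {i} j≡i = subst (Walk A 0 i) (toℕ-injective (sym (trans j≡i (+-identityʳ _)))) (walk-[] A i)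
  path (suc d) {i} {fz}   0≡i+d+1 = contradiction (trans 0≡i+d+1 (+-suc (toℕ i) d)) λ ()
  path (suc d) {i} {fs j} j+1≡i+d+1 =
    walk-snoc A (path d (trans (toℕ-inject₁ j) (suc-injective (trans j+1≡i+d+1 (+-suc (toℕ i) d)))))
                (edge-next⁺ (cong suc (sym (toℕ-inject₁ j))))

  path-to-last : ∀ i → Walk A (p ∸ toℕ i) i last
  path-to-last i = path (p ∸ toℕ i) (trans (toℕ-fromℕ p) (sym (m+[n∸m]≡n (toℕ≤pred[n] i))))

  walk-forced : ∀ t {i j} → toℕ i + t ≤ p → Walk A t i j → toℕ j ≡ toℕ i + t
  walk-forced zero    _ w = trans (cong toℕ (sym (walk-[]⁻ A w))) (sym (+-identityʳ _))
  walk-forced (suc t) {i} bound w with walk-uncons A w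
  ... | k , e , w′ with edge⁻ e
  ...   | inj₁ (i≡p , _) = contradiction (subst (λ x → x + suc t ≤ p) i≡p bound) (m+1+n≰m p)
  ...   | inj₂ k≡i+1 = trans (walk-forced t (subst (_≤ p) (sym k+t≡i+t+1) bound) w′) k+t≡i+t+1
    where
    k+t≡i+t+1 : toℕ k + t ≡ toℕ i + suc t
    k+t≡i+t+1 = trans (cong (_+ t) k≡i+1) (sym (+-suc (toℕ i) t))

  no-short-closed-walk : ∀ {t} → 1 ≤ t → t ≤ p → ¬ Walk A t fz fz
  no-short-closed-walk {t} 1≤t t≤p w = contradiction (subst (1 ≤_) (sym (walk-forced t t≤p w)) 1≤t) λ ()

  exponent-lower-bound : ∀ {e} → IsExponent A e → suc p ≤ e
  exponent-lower-bound {e} (1≤e , pos , _) with e ≤? p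
  ... | yes e≤p = contradiction (walk (pos fz fz)) (no-short-closed-walk 1≤e e≤p)
  ... | no  e≰p = ≰⇒> e≰p

  positive-at-n⇒exponent : Positive (A ^ᴹ suc p) → IsExponent A (suc p)
  positive-at-n⇒exponent pos =
    s≤s z≤n , pos , λ k 1≤k k<n posk → no-short-closed-walk 1≤k (s≤s⁻¹ k<n) (walk (posk fz fz))

  -- Every walk of length n from 0 ends with an edge out of the last vertex.
  walk-ends-at-coefficient : ∀ {j} → Walk A (suc p) fz j → lookup r j ≡ true
  walk-ends-at-coefficient {j} w with walk-unsnoc A w
  ... | k , w′ , e with edge⁻ e
  ...   | inj₁ (_ , rj) = rj
  ...   | inj₂ j≡k+1 = contradiction (trans j≡k+1 (cong suc (walk-forced p ≤-refl w′))) (beyond-last j)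

  exponent-n⇒all-ones : IsExponent A (suc p) → r ≡ replicate (suc p) true
  exponent-n⇒all-ones (_ , pos , _) = all-lookups⇒replicate r (λ j → walk-ends-at-coefficient (walk (pos fz j)))

  -- If row `last` of A^t is positive, then A^(p+t) is positive: from i walk
  -- to the last vertex in p - i steps, then use row `last` of A^(t+i).
  positive-from-last-row : (∀ j → ∃ λ k → Edge A k j) → ∀ {t} → (∀ j → Walk A t last j) → Positive (A ^ᴹ (p + t))
  positive-from-last-row in-edges {t} row i j =
    Walk.positive (walk-cast A length (walk-++ A (path-to-last i) (row-positive-mono A in-edges row (m≤n+m t (toℕ i)) j)))
    where
    length : p ∸ toℕ i + (toℕ i + t) ≡ p + t
    length = trans (sym (+-assoc (p ∸ toℕ i) (toℕ i) t)) (cong (_+ t) (m∸n+n≡m (toℕ≤pred[n] i)))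

  -- Primitivity forces r_0 = 1 (vertex 0 needs an in-neighbour) …
  primitive⇒coefficient-zero : Primitive A → lookup r fz ≡ true
  primitive⇒coefficient-zero prim with edge⁻ (proj₂ (primitive⇒in-edges A prim fz))
  ... | inj₁ (_ , r₀) = r₀

  -- … and, when n ≥ 2, r_s = 1 for some s ≥ 1: otherwise every vertex has at
  -- most one out-neighbour, and walks from 0 could not reach both 0 and last.
  primitive⇒nonzero-coefficient : 1 ≤ p → Primitive A → ∃ λ s → 1 ≤ toℕ s × lookup r s ≡ true
  primitive⇒nonzero-coefficient 1≤p (m , _ , pos) with any? (λ j → (1 ≤? toℕ j) ×-dec (lookup r j ≟ᴮ true))
  ... | yes found = found
  ... | no  none  = contradiction (subst (1 ≤_) (sym 0≡p) 1≤p) λ ()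
    where
    only-zero : ∀ {j} → lookup r j ≡ true → toℕ j ≡ 0
    only-zero {j} rj with 1 ≤? toℕ j
    ... | yes 1≤j = contradiction (j , 1≤j , rj) none
    ... | no  1≰j = n≤0⇒n≡0 (s≤s⁻¹ (≰⇒> 1≰j))

    functional : ∀ {i k k′} → Edge A i k → Edge A i k′ → k ≡ k′
    functional {i} {k} {k′} e e′ with edge⁻ e | edge⁻ e′
    ... | inj₁ (_ , rk) | inj₁ (_ , rk′) = toℕ-injective (trans (only-zero rk) (sym (only-zero rk′)))
    ... | inj₂ k≡i+1 | inj₂ k′≡i+1 = toℕ-injective (trans k≡i+1 (sym k′≡i+1))
    ... | inj₁ (i≡p , _) | inj₂ k′≡i+1 = contradiction (trans k′≡i+1 (cong suc i≡p)) (beyond-last k′)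
    ... | inj₂ k≡i+1 | inj₁ (i≡p , _) = contradiction (trans k≡i+1 (cong suc i≡p)) (beyond-last k)

    0≡p : 0 ≡ p
    0≡p = trans (cong toℕ (walk-deterministic A functional {m} (walk (pos fz fz)) (walk (pos fz last)))) (toℕ-fromℕ p)

  cycle-through-last : ∀ {s} → lookup r s ≡ true → Walk A (suc (p ∸ toℕ s)) last last
  cycle-through-last {s} rs = walk-∷ A (edge-last⁺ (toℕ-fromℕ p) rs) (path-to-last s)

module WielandtBound (q : ℕ) (r : Vec Bool (suc (suc q))) (prim : Primitive (companion (suc (suc q)) r)) where

  p : ℕ
  p = suc q

  open Companion p r

  m : ℕ
  m = proj₁ prim

  in-edges : ∀ j → ∃ λ k → Edge A k j
  in-edges = primitive⇒in-edges A prim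

  s : Fin (suc p)
  s = proj₁ (primitive⇒nonzero-coefficient z<s prim)

  1≤s : 1 ≤ toℕ s
  1≤s = proj₁ (proj₂ (primitive⇒nonzero-coefficient z<s prim))

  rs : lookup r s ≡ true
  rs = proj₂ (proj₂ (primitive⇒nonzero-coefficient z<s prim))

  ℓ≤p : suc (p ∸ toℕ s) ≤ p
  ℓ≤p = s≤s (∸-monoʳ-≤ p 1≤s)

  open CycleChain A (cycle-through-last rs) 1

  -- The chain is full at time m, since 1 + mℓ ≥ m.
  full-at-m : Full (X m)
  full-at-m j = walk⇒∈reach A (row-positive-mono A in-edges (λ j → walk (proj₂ (proj₂ prim) last j))
                                (m≤n⇒m≤1+n (m≤m*n m (suc (p ∸ toℕ s)))) j)

  open GrowingChain X grows stagnation-persists m full-at-m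

  two-at-start : 2 ≤ ∣ X 0 ∣
  two-at-start = two-elements (X 0)
    (walk⇒∈reach A (edge⇒walk A (edge-last⁺ (toℕ-fromℕ p) (primitive⇒coefficient-zero prim))))
    (walk⇒∈reach A (edge⇒walk A (edge-last⁺ (toℕ-fromℕ p) rs)))
    (λ s≡0 → contradiction (subst (λ x → 1 ≤ toℕ x) s≡0 1≤s) λ ())

  grown⇒full : ∣ X 0 ∣ + q ≤ ∣ X q ∣ → Full (X q)
  grown⇒full grown = large⇒full (X q) (≤-trans (+-monoˡ-≤ q two-at-start) grown)

  full-at-q : Full (X q)
  full-at-q = [ (λ full → full) , grown⇒full ]′ (fills q)

  last-row-positive : ∀ j → Walk A (1 + q * p) last j
  last-row-positive = row-positive-mono A in-edges (λ j → ∈reach⇒walk A (full-at-q j)) (s≤s (*-monoʳ-≤ q ℓ≤p))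

  positive : Positive (A ^ᴹ (p * p + 1))
  positive = subst (λ x → Positive (A ^ᴹ x)) p+1+qp≡p*p+1 (positive-from-last-row in-edges last-row-positive)
    where
    p+1+qp≡p*p+1 : p + (1 + q * p) ≡ p * p + 1
    p+1+qp≡p*p+1 = trans (+-suc p (q * p)) (sym (+-comm (p + q * p) 1))

-- Existence: for the all-ones last row the last vertex has an edge to every
-- vertex, so its row of A is positive and A^n > 0.
all-ones-positive : ∀ p → Positive (companion (suc p) (replicate (suc p) true) ^ᴹ suc p)
all-ones-positive p =
  subst (λ x → Positive (A ^ᴹ x)) (+-comm p 1)
        (positive-from-last-row (λ j → last , out-edge j) (λ j → edge⇒walk A (out-edge j)))
  where
  open Companion p (replicate (suc p) true)
  out-edge : ∀ j → Edge A last j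
  out-edge j = edge-last⁺ (toℕ-fromℕ p) (lookup-replicate j true)

mainTheorem4 : (n : ℕ) → 2 ≤ n →
    ((r : Vec Bool n) → Primitive (companion n r) → (e : ℕ) → IsExponent (companion n r) e →
    (n ≤ e) × (e ≤ (n ∸ 1) * (n ∸ 1) + 1))
    × Σ (Vec Bool n) (λ r → Primitive (companion n r) × IsExponent (companion n r) n
    × ((s : Vec Bool n) → Primitive (companion n s) → IsExponent (companion n s) n → s ≡ r))
mainTheorem4 (suc zero)    (s≤s ())
mainTheorem4 (suc (suc q)) _ =
  bounds , ones , (suc p , s≤s z≤n , all-ones-positive p) ,
  Companion.positive-at-n⇒exponent p ones (all-ones-positive p) ,
  λ r _ exp → Companion.exponent-n⇒all-ones p r exp
  where
  p : ℕ
  p = suc q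

  ones : Vec Bool (suc p)
  ones = replicate (suc p) true

  bounds : (r : Vec Bool (suc p)) → Primitive (companion (suc p) r) → (e : ℕ) → IsExponent (companion (suc p) r) e →
           (suc p ≤ e) × (e ≤ p * p + 1)
  bounds r prim e exp =
    Companion.exponent-lower-bound p r exp ,
    exponent≤positive-power (companion (suc p) r) exp (m≤n+m 1 (p * p)) (WielandtBound.positive q r prim)
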